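{- There exists an instance $I$ of HRC such that the instance $I'$ obtained from $I$ by the hospital cloning construction admits a BIS-stable matching, but $I$ admits no BIS-stable matching.
   Context: An instance of HRC consists of residents $R$ and hospitals $H$; residents are single or belong to exactly one couple (an ordered pair $(r_i,r_j)$ of distinct residents). Single residents have strictly ordered preference lists over subsets of $H$; each couple $(r_i,r_j)$ has a strictly ordered joint list over a subset of $H\times H$, where $(h_p,h_q)$ means $r_i\mapsto h_p$, $r_j\mapsto h_q$ is acceptable ($h_p=h_q$ allowed). Each hospital $h_j$ has capacity $c_j\ge1$ and a strictly ordered list over exactly the residents finding it acceptable. A matching $M$: each resident in at most one pair, each hospital $h_j$ in at most $c_j$ pairs, single residents only at acceptable hospitals, each couple either jointly unassigned or assigned to a pair on its list. $M(h)$ = assignees of $h$; under-subscribed means $|M(h)|<$ capacity, full otherwise; unassigned is worse than any acceptable assignment. $M$ is BIS-stable if none of the following holds. (1) A single resident $r_i$ and acceptable hospital $h_j$ with $r_i$ unassigned or preferring $h_j$ to $M(r_i)$ and $h_j$ under-subscribed or preferring $r_i$ to some member of $M(h_j)$. (2) A couple $(r_i,r_j)$ and a hospital $h_k$ such that either (a) $(r_i,r_j)$ prefers $(h_k,M(r_j))$ to $(M(r_i),M(r_j))$ and either (i) $h_k\ne M(r_j)$ and $h_k$ is under-subscribed or prefers $r_i$ to some member of $M(h_k)$, or (ii) $h_k=M(r_j)$ and $h_k$ is under-subscribed or prefers both $r_i$ and $r_j$ to some member of $M(h_k)\setminus\{r_j\}$; or (b) $(r_i,r_j)$ prefers $(M(r_i),h_k)$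 to $(M(r_i),M(r_j))$ and either (i) $h_k\ne M(r_i)$ and $h_k$ is under-subscribed or prefers $r_j$ to some member of $M(h_k)$, or (ii) $h_k=M(r_i)$ and $h_k$ is under-subscribed or prefers both $r_i$ and $r_j$ to some member of $M(h_k)\setminus\{r_i\}$. (3) A couple $(r_i,r_j)$ and hospitals $h_k\ne M(r_i)$, $h_l\ne M(r_j)$ with $(r_i,r_j)$ preferring $(h_k,h_l)$ to $(M(r_i),M(r_j))$ and either (a) $h_k\ne h_l$ and $h_k$ (resp. $h_l$) is under-subscribed or prefers $r_i$ (resp. $r_j$) to at least one of its assignees; or (b) $h_k=h_l$ with at least two free posts; or (c) $h_k=h_l$ with exactly one free post and both $r_i$ and $r_j$ preferred by $h_k$ to some member of $M(h_k)$; or (d) $h_k=h_l$, $h_k$ full, and either (i) $h_k$ prefers each of $r_i,r_j$ to some $r_p\in M(h_k)$ that belongs to a couple with some $r_q\in M(h_k)$, or (ii) the less preferred of $r_i,r_j$ (according to $h_k$) is preferred by $h_k$ to two members of $M(h_k)$. Cloning construction: $I'$ has the same residents and couples as $I$. Each hospital $h_j$ of $I$ is replaced by $c_j$ clones $h_{j,1},\dots,h_{j,c_j}$, each of capacity $1$ with the same preference list as $h_j$. In each single resident's list, each entry $h_j$ is replaced by $h_{j,1},\dots,h_{j,c_j}$. In each couple's list, each entry $(h_{j_1},h_{j_2})$ with $j_1\ne j_2$ is replaced by all pairs $(h_{j_1,a},h_{j_2,b})$ ordered by increasing $b$ then increasing $a$; each entry $(h_j,h_j)$ is replaced by all pairs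 $(h_{j,a},h_{j,b})$ with $a\ne b$, ordered by increasing $b$ then increasing $a$. Replacement sequences keep the order of the original entries. -}

module Defs where

open import Data.Nat using (ℕ; _+_; _≤_; _<_) renaming (_≟_ to _≟ℕ_)
open import Data.Fin using (Fin)
import Data.Fin as Fin
open import Data.Maybe using (Maybe; just; nothing)
import Data.Maybe.Properties as MaybeP
import Data.Product.Properties as ProdP
open import Data.Product using (Σ; Σ-syntax; ∃; ∃-syntax; _×_; _,_; proj₁; proj₂)
open import Data.Sum using (_⊎_)
open import Data.List using (List; []; _∷_; length; filter; concatMap; map; allFin)
open import Data.List.Membership.Propositional using (_∈_; _∉_)
open import Data.List.Relation.Unary.Unique.Propositional using (Unique)
open import Relation.Binary.PropositionalEquality using (_≡_; _≢_)
open import Relation.Binary.Definitions using (DecidableEquality)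
open import Relation.Nullary using (¬_; yes; no)
open import Function.Bundles using (_⇔_)

-- Strict order induced by a preference list: x ≺[ xs ] y means that
-- x occurs in xs before (an occurrence of) y.

data _≺[_]_ {A : Set} : A → List A → A → Set where
  here  : ∀ {x y zs} → y ∈ zs → x ≺[ x ∷ zs ] y
  there : ∀ {x y z zs} → x ≺[ zs ] y → x ≺[ z ∷ zs ] y

-- An HRC instance with residents Fin nR and hospitals of type H.
-- couples : the list of couples, each an ordered pair (r_i , r_j).
-- singlePref r : preference list of r (meaningful when r is single).
-- couplePref (r_i , r_j) : joint list of the couple (meaningful for couples).
-- hospPref h : preference list of h;  cap h : capacity of h.

record HRC (nR : ℕ) (H : Set) : Set where
  field
    couples    : List (Fin nR × Fin nR)
    singlePref : Fin nR → List H
    couplePref : Fin nR × Fin nR → List (H × H)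
    cap        : H → ℕ
    hospPref   : H → List (Fin nR)

module _ {nR : ℕ} {H : Set} (I : HRC nR H) where
  open HRC I

  coupleMembers : List (Fin nR)
  coupleMembers = concatMap (λ c → proj₁ c ∷ proj₂ c ∷ []) couples

  IsSingle : Fin nR → Set
  IsSingle r = r ∉ coupleMembers

  Acceptable : Fin nR → H → Set
  Acceptable r h =
      (IsSingle r × h ∈ singlePref r)
    ⊎ (∃[ r' ] ((r , r') ∈ couples × ∃[ h' ] ((h , h') ∈ couplePref (r , r'))))
    ⊎ (∃[ r' ] ((r' , r) ∈ couples × ∃[ h' ] ((h' , h) ∈ couplePref (r' , r))))

  record WellFormed : Set where
    field
      -- each resident belongs to at most one couple, couples consist of
      -- two distinct residents
      couplesDisjoint : Unique coupleMembers
      singleStrict    : ∀ r → IsSingle r → Unique (singlePref r)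
      coupleStrict    : ∀ c → c ∈ couples → Unique (couplePref c)
      capPos          : ∀ h → 1 ≤ cap h
      hospStrict      : ∀ h → Unique (hospPref h)
      hospExact       : ∀ h r → (r ∈ hospPref h) ⇔ Acceptable r h

-- Matchings and BIS-stability (needs decidable equality on hospitals,
-- to count the assignees of a hospital).

module Stability {nR : ℕ} {H : Set} (_≟H_ : DecidableEquality H)
                 (I : HRC nR H) where
  open HRC I

  -- an assignment: M r = just h  iff  (r , h) ∈ M
  Assignment : Set
  Assignment = Fin nR → Maybe H

  module _ (M : Assignment) where

    count : H → ℕ
    count h = length (filter (λ r → MaybeP.≡-dec _≟H_ (M r) (just h)) (allFin nR))

    record IsMatching : Set where
      field
        capacity : ∀ h → count h ≤ cap h
        singleOk : ∀ r → IsSingle I r → ∀ h → M r ≡ just h → h ∈ singlePref r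
        coupleOk : ∀ ri rj → (ri , rj) ∈ couples →
                     (M ri ≡ nothing × M rj ≡ nothing)
                   ⊎ (Σ[ hp ∈ H ] Σ[ hq ∈ H ]
                        (M ri ≡ just hp × M rj ≡ just hq × (hp , hq) ∈ couplePref (ri , rj)))

    UnderSubscribed : H → Set
    UnderSubscribed h = count h < cap h

    Full : H → Set
    Full h = cap h ≤ count h

    HPrefers : H → Fin nR → Fin nR → Set
    HPrefers h r r' = r ≺[ hospPref h ] r'

    PrefersToSome : H → Fin nR → Set
    PrefersToSome h r = ∃[ r' ] (M r' ≡ just h × HPrefers h r r')

    SPrefers : Fin nR → H → Set
    SPrefers r h = h ∈ singlePref r ×
      (M r ≡ nothing ⊎ ∃[ h' ] (M r ≡ just h' × h ≺[ singlePref r ] h'))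

    CPrefers : Fin nR → Fin nR → H × H → Set
    CPrefers ri rj p = p ∈ couplePref (ri , rj) ×
      ((M ri ≡ nothing × M rj ≡ nothing)
       ⊎ (∃[ a ] ∃[ b ] (M ri ≡ just a × M rj ≡ just b × p ≺[ couplePref (ri , rj) ] (a , b))))

    BlockType1 : Set
    BlockType1 = ∃[ r ] ∃[ h ] (IsSingle I r × SPrefers r h ×
                   (UnderSubscribed h ⊎ PrefersToSome h r))

    BlockType2 : Set
    BlockType2 = ∃[ ri ] ∃[ rj ] ((ri , rj) ∈ couples × ∃[ hk ] (
      (∃[ b ] (M rj ≡ just b × CPrefers ri rj (hk , b) ×
         ((hk ≢ b × (UnderSubscribed hk ⊎ PrefersToSome hk ri))
          ⊎ (hk ≡ b × (UnderSubscribed hk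
               ⊎ ∃[ r' ] (M r' ≡ just hk × r' ≢ rj × HPrefers hk ri r' × HPrefers hk rj r'))))))
      ⊎
      (∃[ a ] (M ri ≡ just a × CPrefers ri rj (a , hk) ×
         ((hk ≢ a × (UnderSubscribed hk ⊎ PrefersToSome hk rj))
          ⊎ (hk ≡ a × (UnderSubscribed hk
               ⊎ ∃[ r' ] (M r' ≡ just hk × r' ≢ ri × HPrefers hk ri r' × HPrefers hk rj r'))))))))

    LessPreferred : H → Fin nR → Fin nR → Fin nR → Set
    LessPreferred h ri rj w = (w ≡ rj × HPrefers h ri rj) ⊎ (w ≡ ri × HPrefers h rj ri)

    BlockType3 : Set
    BlockType3 = ∃[ ri ] ∃[ rj ] ((ri , rj) ∈ couples × ∃[ hk ] ∃[ hl ] (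
      just hk ≢ M ri × just hl ≢ M rj × CPrefers ri rj (hk , hl) × (
        (hk ≢ hl × (UnderSubscribed hk ⊎ PrefersToSome hk ri)
                 × (UnderSubscribed hl ⊎ PrefersToSome hl rj))
      ⊎ (hk ≡ hl × count hk + 2 ≤ cap hk)
      ⊎ (hk ≡ hl × count hk + 1 ≡ cap hk ×
           ∃[ r' ] (M r' ≡ just hk × HPrefers hk ri r' × HPrefers hk rj r'))
      ⊎ (hk ≡ hl × Full hk × (
           (∃[ rp ] ∃[ rq ] (M rp ≡ just hk × M rq ≡ just hk ×
              ((rp , rq) ∈ couples ⊎ (rq , rp) ∈ couples) ×
              HPrefers hk ri rp × HPrefers hk rj rp))
         ⊎ (∃[ w ] (LessPreferred hk ri rj w × ∃[ r₁ ] ∃[ r₂ ] (r₁ ≢ r₂ ×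
              M r₁ ≡ just hk × M r₂ ≡ just hk × HPrefers hk w r₁ × HPrefers hk w r₂))))))))

    BISStable : Set
    BISStable = IsMatching × ¬ (BlockType1 ⊎ BlockType2 ⊎ BlockType3)

  HasBISStable : Set
  HasBISStable = ∃[ M ] BISStable M

module Cloning {nR : ℕ} {H : Set} (_≟H_ : DecidableEquality H)
               (I : HRC nR H) where
  open HRC I

  Clone : Set
  Clone = Σ H (λ h → Fin (cap h))

  _≟C_ : DecidableEquality Clone
  _≟C_ = ProdP.≡-dec _≟H_ Fin._≟_

  clones : H → List Clone
  clones h = map (h ,_) (allFin (cap h))

  -- replacement of a couple entry (h1 , h2): pairs ((h1,a),(h2,b)) ordered
  -- by increasing b then increasing a; if h1 = h2 only pairs with a ≠ b
  cloneEntry : H × H → List (Clone × Clone)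
  cloneEntry (h₁ , h₂) with h₁ ≟H h₂
  ... | no _  = concatMap (λ b → map (λ a → ((h₁ , a) , (h₂ , b))) (allFin (cap h₁)))
                          (allFin (cap h₂))
  ... | yes _ = concatMap (λ b → concatMap (λ a → pick a b) (allFin (cap h₁)))
                          (allFin (cap h₂))
    where
      pick : Fin (cap h₁) → Fin (cap h₂) → List (Clone × Clone)
      pick a b with Fin.toℕ a ≟ℕ Fin.toℕ b
      ... | yes _ = []
      ... | no _  = ((h₁ , a) , (h₂ , b)) ∷ []

  clone : HRC nR Clone
  clone = record
    { couples    = couples
    ; singlePref = λ r → concatMap clones (singlePref r)
    ; couplePref = λ c → concatMap cloneEntry (couplePref c)
    ; cap        = λ _ → 1
    ; hospPref   = λ hc → hospPref (proj₁ hc)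
    }

-- Take residents r₀ … r₃ forming the couples (r₀ , r₁) and (r₂ , r₃), and hospitals h₀ of
-- capacity 1 and h₁ of capacity 2, where h₁ ranks r₀ > r₃ > r₂ > r₁.  The couple (r₀ , r₁)
-- wants (h₁ , h₁) and then (h₁ , h₀), the couple (r₂ , r₃) only wants (h₁ , h₁).  Of the four
-- matchings of I, the empty one and the one placing (r₀ , r₁) at (h₁ , h₀) are blocked by a
-- couple wanting free posts; the one placing (r₂ , r₃) at h₁ is blocked by (r₀ , r₁) since h₁
-- prefers r₀ to r₂; and the one placing (r₀ , r₁) at h₁ is blocked by (r₂ , r₃) through
-- condition 3(d)(i), which lets a full hospital evict a whole couple.  After cloning, both
-- wishes of the couples for h₁ become pairs of distinct single-post clones, so 3(d) can no
-- longer fire: with (r₀ , r₁) on the two clones of h₁, every blocking attempt needs the clone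
-- holding r₀, which is full and prefers nobody to its favourite r₀.
module Submission where

open import Defs
open import Data.Nat using (ℕ; z≤n; s≤s; _≤_; _<_; _+_)
open import Data.Nat.Properties using (≤-refl; <⇒≱)
open import Data.Fin using (Fin; zero; suc)
open import Data.Fin.Properties using (_≟_)
open import Data.Product using (Σ-syntax; _×_; _,_; proj₁; proj₂)
open import Data.Sum using (_⊎_; inj₁; inj₂)
open import Data.Empty using (⊥-elim)
open import Data.Maybe using (Maybe; just; nothing)
open import Data.List using (List; []; _∷_; length; allFin)
open import Data.List.Properties using (filter-≐)
open import Data.List.Membership.Propositional using (_∈_)
open import Data.List.Relation.Unary.Any using (here; there)
open import Data.List.Relation.Unary.All using ([]; _∷_)
open import Data.List.Relation.Unary.All.Properties using (All¬⇒¬Any)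
open import Data.List.Relation.Unary.AllPairs using ([]; _∷_)
open import Data.List.Relation.Unary.Unique.Propositional using (Unique)
open import Relation.Binary.Definitions using (DecidableEquality)
open import Relation.Binary.PropositionalEquality using (_≡_; _≢_; _≗_; refl; sym; trans; cong; subst)
open import Relation.Nullary using (¬_)
open import Function.Bundles using (mk⇔)
import Data.Maybe.Properties as MaybeP

≺-right-∈ : ∀ {A : Set} {x y : A} {xs} → x ≺[ xs ] y → y ∈ xs
≺-right-∈ (here y∈xs) = there y∈xs
≺-right-∈ (there x≺y) = there (≺-right-∈ x≺y)

≺-right-∈-tail : ∀ {A : Set} {x y z : A} {zs} → x ≺[ z ∷ zs ] y → y ∈ zs
≺-right-∈-tail (here y∈zs) = y∈zs
≺-right-∈-tail (there x≺y) = ≺-right-∈ x≺y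

¬≺-head : ∀ {A : Set} {x y : A} {ys} → Unique (y ∷ ys) → ¬ x ≺[ y ∷ ys ] y
¬≺-head (y∉ys ∷ _) x≺y = All¬⇒¬Any y∉ys (≺-right-∈-tail x≺y)

just≢-unassigned : ∀ {A : Set} {a : A} {m} → m ≡ nothing → just a ≢ m
just≢-unassigned refl ()

unequal⇒first : ∀ {X A B C D : Set} {x y : X} →
                x ≢ y → A ⊎ (x ≡ y × B) ⊎ (x ≡ y × C) ⊎ (x ≡ y × D) → A
unequal⇒first _   (inj₁ a)                       = a
unequal⇒first x≢y (inj₂ (inj₁ (x≡y , _)))         = ⊥-elim (x≢y x≡y)
unequal⇒first x≢y (inj₂ (inj₂ (inj₁ (x≡y , _)))) = ⊥-elim (x≢y x≡y)
unequal⇒first x≢y (inj₂ (inj₂ (inj₂ (x≡y , _)))) = ⊥-elim (x≢y x≡y)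

module _ {nR : ℕ} {H : Set} (_≟H_ : DecidableEquality H) (I : HRC nR H) where
  open Stability _≟H_ I

  count-≗ : ∀ {M N : Assignment} → M ≗ N → ∀ h → count M h ≡ count N h
  count-≗ {M} {N} M≗N h = cong length (filter-≐ (λ r → MaybeP.≡-dec _≟H_ (M r) (just h))
                                                (λ r → MaybeP.≡-dec _≟H_ (N r) (just h))
                                                ((λ {r} p → trans (sym (M≗N r)) p) , (λ {r} p → trans (M≗N r) p))
                                                (allFin nR))

pattern r₀ = zero
pattern r₁ = suc zero
pattern r₂ = suc (suc zero)
pattern r₃ = suc (suc (suc zero))

pattern h₀ = zero
pattern h₁ = suc zero

coupleList : Fin 4 × Fin 4 → List (Fin 2 × Fin 2)
coupleList (r₀ , r₁) = (h₁ , h₁) ∷ (h₁ , h₀) ∷ []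
coupleList (r₂ , r₃) = (h₁ , h₁) ∷ []
coupleList _         = []

hospitalCapacity : Fin 2 → ℕ
hospitalCapacity h₀ = 1
hospitalCapacity h₁ = 2

hospitalList : Fin 2 → List (Fin 4)
hospitalList h₀ = r₁ ∷ []
hospitalList h₁ = r₀ ∷ r₃ ∷ r₂ ∷ r₁ ∷ []

I : HRC 4 (Fin 2)
I = record
  { couples    = (r₀ , r₁) ∷ (r₂ , r₃) ∷ []
  ; singlePref = λ _ → []
  ; couplePref = coupleList
  ; cap        = hospitalCapacity
  ; hospPref   = hospitalList
  }

everyone-coupled : ∀ r → r ∈ coupleMembers I
everyone-coupled r₀ = here refl
everyone-coupled r₁ = there (here refl)
everyone-coupled r₂ = there (there (here refl))
everyone-coupled r₃ = there (there (there (here refl)))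

ranked⇒acceptable : ∀ h r → r ∈ hospitalList h → Acceptable I r h
ranked⇒acceptable h₀ _ (here refl)                         = inj₂ (inj₂ (r₀ , here refl , h₁ , there (here refl)))
ranked⇒acceptable h₁ _ (here refl)                         = inj₂ (inj₁ (r₁ , here refl , h₁ , here refl))
ranked⇒acceptable h₁ _ (there (here refl))                 = inj₂ (inj₂ (r₂ , there (here refl) , h₁ , here refl))
ranked⇒acceptable h₁ _ (there (there (here refl)))         = inj₂ (inj₁ (r₃ , there (here refl) , h₁ , here refl))
ranked⇒acceptable h₁ _ (there (there (there (here refl)))) = inj₂ (inj₂ (r₀ , here refl , h₁ , here refl))

acceptable⇒ranked : ∀ h r → Acceptable I r h → r ∈ hospitalList h
acceptable⇒ranked _ r (inj₁ (single , _)) = ⊥-elim (single (everyone-coupled r))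
acceptable⇒ranked _ _ (inj₂ (inj₁ (_ , here refl , _ , here refl)))         = here refl
acceptable⇒ranked _ _ (inj₂ (inj₁ (_ , here refl , _ , there (here refl)))) = here refl
acceptable⇒ranked _ _ (inj₂ (inj₁ (_ , there (here refl) , _ , here refl))) = there (there (here refl))
acceptable⇒ranked _ _ (inj₂ (inj₂ (_ , here refl , _ , here refl)))         = there (there (there (here refl)))
acceptable⇒ranked _ _ (inj₂ (inj₂ (_ , here refl , _ , there (here refl)))) = here refl
acceptable⇒ranked _ _ (inj₂ (inj₂ (_ , there (here refl) , _ , here refl))) = there (here refl)

hospitalList-unique : ∀ h → Unique (hospitalList h)
hospitalList-unique h₀ = [] ∷ []
hospitalList-unique h₁ = ((λ ()) ∷ (λ ()) ∷ (λ ()) ∷ []) ∷ ((λ ()) ∷ (λ ()) ∷ []) ∷ ((λ ()) ∷ []) ∷ [] ∷ []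

coupleList-unique : ∀ c → c ∈ HRC.couples I → Unique (coupleList c)
coupleList-unique _ (here refl)         = ((λ ()) ∷ []) ∷ [] ∷ []
coupleList-unique _ (there (here refl)) = [] ∷ []

capacity-positive : ∀ h → 1 ≤ hospitalCapacity h
capacity-positive h₀ = s≤s z≤n
capacity-positive h₁ = s≤s z≤n

I-wellFormed : WellFormed I
I-wellFormed = record
  { couplesDisjoint = ((λ ()) ∷ (λ ()) ∷ (λ ()) ∷ []) ∷ ((λ ()) ∷ (λ ()) ∷ []) ∷ ((λ ()) ∷ []) ∷ [] ∷ []
  ; singleStrict    = λ _ _ → []
  ; coupleStrict    = coupleList-unique
  ; capPos          = capacity-positive
  ; hospStrict      = hospitalList-unique
  ; hospExact       = λ h r → mk⇔ (ranked⇒acceptable h r) (acceptable⇒ranked h r)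
  }

module SI = Stability _≟_ I
open SI.IsMatching

assignment : (a b c d : Maybe (Fin 2)) → Fin 4 → Maybe (Fin 2)
assignment a b c d r₀ = a
assignment a b c d r₁ = b
assignment a b c d r₂ = c
assignment a b c d r₃ = d

≗-assignment : ∀ {M a b c d} → M r₀ ≡ a → M r₁ ≡ b → M r₂ ≡ c → M r₃ ≡ d →
               M ≗ assignment a b c d
≗-assignment e₀ e₁ e₂ e₃ r₀ = e₀
≗-assignment e₀ e₁ e₂ e₃ r₁ = e₁
≗-assignment e₀ e₁ e₂ e₃ r₂ = e₂
≗-assignment e₀ e₁ e₂ e₃ r₃ = e₃

blocked-if-empty : ∀ {M} → M ≗ assignment nothing nothing nothing nothing → SI.BlockType3 M
blocked-if-empty M≗ =
  r₂ , r₃ , there (here refl) , h₁ , h₁ ,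
  just≢-unassigned (M≗ r₂) , just≢-unassigned (M≗ r₃) , (here refl , inj₁ (M≗ r₂ , M≗ r₃)) ,
  inj₂ (inj₁ (refl , subst (λ n → n + 2 ≤ 2) (sym (count-≗ _≟_ I M≗ h₁)) ≤-refl))

blocked-if-r₂r₃-at-h₁ : ∀ {M} → M ≗ assignment nothing nothing (just h₁) (just h₁) → SI.BlockType3 M
blocked-if-r₂r₃-at-h₁ M≗ =
  r₀ , r₁ , here refl , h₁ , h₀ ,
  just≢-unassigned (M≗ r₀) , just≢-unassigned (M≗ r₁) , (there (here refl) , inj₁ (M≗ r₀ , M≗ r₁)) ,
  inj₁ ((λ ()) , inj₂ (r₂ , M≗ r₂ , here (there (here refl))) ,
        inj₁ (subst (_< 1) (sym (count-≗ _≟_ I M≗ h₀)) (s≤s z≤n)))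

blocked-if-r₀r₁-at-h₁ : ∀ {M} → M ≗ assignment (just h₁) (just h₁) nothing nothing → SI.BlockType3 M
blocked-if-r₀r₁-at-h₁ M≗ =
  r₂ , r₃ , there (here refl) , h₁ , h₁ ,
  just≢-unassigned (M≗ r₂) , just≢-unassigned (M≗ r₃) , (here refl , inj₁ (M≗ r₂ , M≗ r₃)) ,
  inj₂ (inj₂ (inj₂ (refl , subst (2 ≤_) (sym (count-≗ _≟_ I M≗ h₁)) ≤-refl ,
    inj₁ (r₁ , r₀ , M≗ r₁ , M≗ r₀ , inj₂ (here refl) ,
          there (there (here (here refl))) , there (here (there (here refl)))))))

blocked-if-r₀r₁-at-h₁h₀ : ∀ {M} → M ≗ assignment (just h₁) (just h₀) nothing nothing → SI.BlockType2 M
blocked-if-r₀r₁-at-h₁h₀ M≗ =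
  r₀ , r₁ , here refl , h₁ ,
  inj₂ (h₁ , M≗ r₀ , (here refl , inj₂ (h₁ , h₀ , M≗ r₀ , M≗ r₁ , here (here refl))) ,
        inj₂ (refl , inj₁ (subst (_< 2) (sym (count-≗ _≟_ I M≗ h₁)) (s≤s (s≤s z≤n)))))

h₁-overfull : ∀ {M} b → M ≗ assignment (just h₁) b (just h₁) (just h₁) → 2 < SI.count M h₁
h₁-overfull b M≗ = subst (2 <_) (sym (count-≗ _≟_ I M≗ h₁)) (three-at-h₁ b)
  where
    three-at-h₁ : ∀ b → 3 ≤ SI.count (assignment (just h₁) b (just h₁) (just h₁)) h₁
    three-at-h₁ nothing   = s≤s (s≤s (s≤s z≤n))
    three-at-h₁ (just h₀) = s≤s (s≤s (s≤s z≤n))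
    three-at-h₁ (just h₁) = s≤s (s≤s (s≤s z≤n))

I-noStable : ∀ M → ¬ SI.BISStable M
I-noStable M (matching , unblocked)
  with coupleOk matching r₀ r₁ (here refl) | coupleOk matching r₂ r₃ (there (here refl))
... | inj₁ (e₀ , e₁) | inj₁ (e₂ , e₃) =
  unblocked (inj₂ (inj₂ (blocked-if-empty (≗-assignment e₀ e₁ e₂ e₃))))
... | inj₁ (e₀ , e₁) | inj₂ (_ , _ , e₂ , e₃ , here refl) =
  unblocked (inj₂ (inj₂ (blocked-if-r₂r₃-at-h₁ (≗-assignment e₀ e₁ e₂ e₃))))
... | inj₂ (_ , _ , e₀ , e₁ , here refl) | inj₁ (e₂ , e₃) =
  unblocked (inj₂ (inj₂ (blocked-if-r₀r₁-at-h₁ (≗-assignment e₀ e₁ e₂ e₃))))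
... | inj₂ (_ , _ , e₀ , e₁ , there (here refl)) | inj₁ (e₂ , e₃) =
  unblocked (inj₂ (inj₁ (blocked-if-r₀r₁-at-h₁h₀ (≗-assignment e₀ e₁ e₂ e₃))))
... | inj₂ (_ , _ , e₀ , e₁ , here refl) | inj₂ (_ , _ , e₂ , e₃ , here refl) =
  <⇒≱ (h₁-overfull {M} _ (≗-assignment e₀ e₁ e₂ e₃)) (capacity matching h₁)
... | inj₂ (_ , _ , e₀ , e₁ , there (here refl)) | inj₂ (_ , _ , e₂ , e₃ , here refl) =
  <⇒≱ (h₁-overfull {M} _ (≗-assignment e₀ e₁ e₂ e₃)) (capacity matching h₁)
... | inj₂ (_ , _ , _ , _ , there (there ())) | _
... | _ | inj₂ (_ , _ , _ , _ , there ())

I′ : HRC 4 (Cloning.Clone _≟_ I)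
I′ = Cloning.clone _≟_ I

module SC = Stability (Cloning._≟C_ _≟_ I) I′

h₁-clone₀ h₁-clone₁ : Cloning.Clone _≟_ I
h₁-clone₀ = h₁ , zero
h₁-clone₁ = h₁ , suc zero

M′ : Fin 4 → Maybe (Cloning.Clone _≟_ I)
M′ r₀ = just h₁-clone₀
M′ r₁ = just h₁-clone₁
M′ _  = nothing

M′-matching : SC.IsMatching M′
M′-matching = record
  { capacity = at-most-one
  ; singleOk = λ r single _ _ → ⊥-elim (single (everyone-coupled r))
  ; coupleOk = couples-ok
  }
  where
    at-most-one : ∀ h → SC.count M′ h ≤ 1
    at-most-one (h₀ , zero)     = z≤n
    at-most-one (h₁ , zero)     = s≤s z≤n
    at-most-one (h₁ , suc zero) = s≤s z≤n
    couples-ok : ∀ ri rj → (ri , rj) ∈ HRC.couples I′ →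
                   (M′ ri ≡ nothing × M′ rj ≡ nothing)
                 ⊎ (Σ[ hp ∈ Cloning.Clone _≟_ I ] Σ[ hq ∈ Cloning.Clone _≟_ I ]
                      (M′ ri ≡ just hp × M′ rj ≡ just hq × (hp , hq) ∈ HRC.couplePref I′ (ri , rj)))
    couples-ok _ _ (here refl)         = inj₂ (h₁-clone₀ , h₁-clone₁ , refl , refl , there (here refl))
    couples-ok _ _ (there (here refl)) = inj₁ (refl , refl)

h₁-clone₀-closed : ∀ r → ¬ (SC.UnderSubscribed M′ h₁-clone₀ ⊎ SC.PrefersToSome M′ h₁-clone₀ r)
h₁-clone₀-closed _ (inj₁ (s≤s ()))
h₁-clone₀-closed _ (inj₂ (r₀ , _ , r≺r₀)) = ¬≺-head (hospitalList-unique h₁) r≺r₀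
h₁-clone₀-closed _ (inj₂ (r₁ , () , _))
h₁-clone₀-closed _ (inj₂ (r₂ , () , _))
h₁-clone₀-closed _ (inj₂ (r₃ , () , _))

only-improvement-of-r₀r₁ : ∀ {p} → p ≺[ HRC.couplePref I′ (r₀ , r₁) ] (h₁-clone₀ , h₁-clone₁) →
                           p ≡ (h₁-clone₁ , h₁-clone₀)
only-improvement-of-r₀r₁ (here _) = refl
only-improvement-of-r₀r₁ (there p≺) with ≺-right-∈-tail p≺
... | here ()
... | there (here ())
... | there (there ())

M′-unblocked : ¬ (SC.BlockType1 M′ ⊎ SC.BlockType2 M′ ⊎ SC.BlockType3 M′)
M′-unblocked (inj₁ (r , _ , single , _)) = single (everyone-coupled r)
M′-unblocked (inj₂ (inj₁ (_ , _ , here refl , _ , inj₁ (_ , refl , (_ , inj₂ (_ , _ , refl , refl , p≺)) , _))))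
  with only-improvement-of-r₀r₁ p≺
... | ()
M′-unblocked (inj₂ (inj₁ (_ , _ , here refl , _ , inj₂ (_ , refl , (_ , inj₂ (_ , _ , refl , refl , p≺)) , _))))
  with only-improvement-of-r₀r₁ p≺
... | ()
M′-unblocked (inj₂ (inj₁ (_ , _ , there (here refl) , _ , inj₁ (_ , () , _))))
M′-unblocked (inj₂ (inj₁ (_ , _ , there (here refl) , _ , inj₂ (_ , () , _))))
M′-unblocked (inj₂ (inj₂ (_ , _ , here refl , _ , _ , _ , _ , (_ , inj₂ (_ , _ , refl , refl , p≺)) , cond)))
  with only-improvement-of-r₀r₁ p≺
... | refl = h₁-clone₀-closed r₁ (proj₂ (proj₂ (unequal⇒first (λ ()) cond)))
M′-unblocked (inj₂ (inj₂ (_ , _ , there (here refl) , _ , _ , _ , _ , (here refl , _) , cond))) =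
  h₁-clone₀-closed r₃ (proj₂ (proj₂ (unequal⇒first (λ ()) cond)))
M′-unblocked (inj₂ (inj₂ (_ , _ , there (here refl) , _ , _ , _ , _ , (there (here refl) , _) , cond))) =
  h₁-clone₀-closed r₂ (proj₁ (proj₂ (unequal⇒first (λ ()) cond)))
M′-unblocked (inj₂ (inj₂ (_ , _ , there (here refl) , _ , _ , _ , _ , (there (there ()) , _) , _)))

corollary15 : Σ[ nR ∈ ℕ ] Σ[ nH ∈ ℕ ] Σ[ I ∈ HRC nR (Fin nH) ]
                (WellFormed I
                 × Stability.HasBISStable (Cloning._≟C_ _≟_ I) (Cloning.clone _≟_ I)
                 × ¬ Stability.HasBISStable _≟_ I)
corollary15 = 4 , 2 , I , I-wellFormed , (M′ , M′-matching , M′-unblocked) , λ (M , stable) → I-noStable M stable
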